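{- Let $n\ge 5$. The subgraph $\Gamma$ of $\mathrm{Cay}(\mathrm{Sym}_n,T_n)$ induced on the vertex set $T_n$ is a $2(n-2)$-regular graph.
   Context: $\mathrm{Sym}_n$ is the symmetric group on $[n]$, permutations in one-line notation, $(\pi\circ\rho)(t)=\pi(\rho(t))$. For integers $0\le i<j<k\le n$ the block transposition $\sigma(i,j,k)$ is the permutation $[1\cdots i\ \ j+1\cdots k\ \ i+1\cdots j\ \ k+1\cdots n]$; $T_n$ is the set of all block transpositions. $\mathrm{Cay}(\mathrm{Sym}_n,T_n)$ has vertex set $\mathrm{Sym}_n$, with $\pi\sim\rho$ iff $\rho=\pi\circ\sigma$ for some $\sigma\in T_n$. -}

module Defs where

open import Data.Nat using (ℕ; _+_; _*_; _∸_; _<_; _≤_; _<?_)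
open import Data.Fin using (Fin; toℕ; fromℕ<)
open import Data.Vec using (Vec; tabulate; lookup)
open import Data.Product using (Σ; ∃; _×_; _,_)
open import Data.List using (List; length)
open import Data.List.Relation.Unary.Unique.Propositional using (Unique)
open import Data.List.Membership.Propositional using (_∈_)
open import Function.Bundles using (_⇔_)
open import Relation.Nullary using (yes; no)
open import Relation.Binary.PropositionalEquality using (_≡_)

-- Permutations of [n] in one-line notation, 0-based:
-- entry t (t = 0 .. n-1) is the image of the point t+1, shifted down by 1.
Perm : ℕ → Set
Perm n = Vec (Fin n) n

_∘ₚ_ : ∀ {n} → Perm n → Perm n → Perm n
π ∘ₚ ρ = tabulate (λ t → lookup π (lookup ρ t))

-- 0-based image of position t under σ(i,j,k) = [1..i, j+1..k, i+1..j, k+1..n].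
btVal : ℕ → ℕ → ℕ → ℕ → ℕ
btVal i j k t with t <? i
... | yes _ = t
... | no _ with t <? i + (k ∸ j)
...   | yes _ = j + (t ∸ i)
...   | no _ with t <? k
...     | yes _ = t ∸ (k ∸ j)
...     | no _ = t

-- Convert back to Fin n; the fallback branch is unreachable whenever k ≤ n
-- (btVal maps [0,n) into [0,n)), it only serves to make the function total.
btFin : ∀ {n} → ℕ → ℕ → ℕ → Fin n → Fin n
btFin {n} i j k t with btVal i j k (toℕ t) <? n
... | yes p = fromℕ< p
... | no _ = t

σ : (n i j k : ℕ) → Perm n
σ n i j k = tabulate (btFin i j k)

IsBT : ∀ n → Perm n → Set
IsBT n π = Σ ℕ λ i → Σ ℕ λ j → Σ ℕ λ k →
  (i < j) × (j < k) × (k ≤ n) × (π ≡ σ n i j k)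

Adj : ∀ n → Perm n → Perm n → Set
Adj n π ρ = Σ (Perm n) λ τ → IsBT n τ × (ρ ≡ π ∘ₚ τ)

HasDegreeInT : ∀ n → Perm n → ℕ → Set
HasDegreeInT n π d = Σ (List (Perm n)) λ ns →
  Unique ns × (∀ ρ → (ρ ∈ ns) ⇔ (IsBT n ρ × Adj n π ρ)) × (length ns ≡ d)

InducedRegular : ℕ → ℕ → Set
InducedRegular n d = ∀ π → IsBT n π → HasDegreeInT n π d

module Submission where

-- Work with block transpositions as bijections of ℕ and with their breakpoints, the positions t
-- where g t ≠ g (t − 1) + 1. The block transposition σ(i, j, k) has exactly the breakpoints
-- i < q < k with q = i + (k − j), and conversely a bijection of ℕ that is the identity from some
-- point on and has exactly three breakpoints is a block transposition. For W = σ(i, j, k) and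
-- τ = σ(a, b, c) with breakpoints a < p < c, a position outside {a, p, c} is a breakpoint of W ∘ τ
-- exactly when τ maps it to a breakpoint of W, while a, p and c stay breakpoints unless (a, b),
-- (c, a) resp. (b, c) is one of the cyclically consecutive pairs (i, q), (q, k), (k, i) of
-- breakpoints of W. Counting breakpoints, W ∘ τ is a block transposition exactly when one of
-- a, p, c is glued and two of i, q, k are among a, b, c. This gives five families of τ, which
-- between them use each of the gaps [0, i), (i, q), (q, k), (k, n] between breakpoints twice; the
-- gaps have total length n − 2.

open import Data.Empty using (⊥-elim)
open import Data.Fin using (toℕ; fromℕ<)
open import Data.Fin.Properties using (toℕ-injective; toℕ<n; toℕ-fromℕ<)
open import Data.List using (List; []; _∷_; _++_; map; concat; length; applyUpTo)
open import Data.List.Properties using (length-++; length-map; length-applyUpTo)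
open import Data.List.Membership.Propositional using (_∈_)
open import Data.List.Membership.Propositional.Properties
  using (∈-map⁺; ∈-map⁻; ∈-++⁺ˡ; ∈-++⁺ʳ; ∈-++⁻; ∈-concat⁺; ∈-concat⁻; ∈-applyUpTo⁺; ∈-applyUpTo⁻)
open import Data.List.Relation.Binary.Disjoint.Propositional using (Disjoint)
import Data.List.Relation.Unary.All as All
import Data.List.Relation.Unary.All.Properties as All
open import Data.List.Relation.Unary.AllPairs using (AllPairs; []; _∷_)
open import Data.List.Relation.Unary.Any using (Any; here; there)
open import Data.List.Relation.Unary.Unique.Propositional using (Unique)
open import Data.List.Relation.Unary.Unique.Propositional.Properties using (++⁺; concat⁺; applyUpTo⁺₁)
open import Data.Nat using (ℕ; zero; suc; _+_; _*_; _∸_; _≤_; _<_; z≤n; s≤s; z<s)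
open import Data.Nat.ListAction using (sum)
open import Data.Nat.Properties
open import Data.Nat.Tactic.RingSolver using (solve-∀)
open import Data.Product using (Σ; _×_; _,_; proj₁; proj₂)
open import Data.Sum using (_⊎_; inj₁; inj₂)
open import Data.Vec using (lookup; tabulate)
open import Data.Vec.Properties using (lookup∘tabulate; tabulate∘lookup; tabulate-cong)
open import Function using (_∘_; id)
open import Function.Bundles using (_⇔_; mk⇔; Equivalence)
open import Relation.Binary.Definitions using (tri<; tri≈; tri>)
open import Relation.Binary.PropositionalEquality
open import Relation.Nullary using (¬_; yes; no; Dec)

open import Defs

-- Runs and breakpoints of a function ℕ → ℕ

-- Position t continues the run of g if g t = g (t − 1) + 1, reading g (−1) as −1; otherwise t is a
-- breakpoint of g.
continuation : (ℕ → ℕ) → ℕ → ℕ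
continuation g zero    = zero
continuation g (suc t) = suc (g t)

Continues : (ℕ → ℕ) → ℕ → Set
Continues g t = g t ≡ continuation g t

continues? : ∀ g t → Dec (Continues g t)
continues? g t = g t ≟ continuation g t

continues-id : ∀ t → Continues id t
continues-id zero    = refl
continues-id (suc t) = refl

continuation-∘ : ∀ (g f : ℕ → ℕ) t → continuation (g ∘ f) t ≡ continuation g (continuation f t)
continuation-∘ g f zero    = refl
continuation-∘ g f (suc t) = refl

Continues-resp-≗ : ∀ {f h : ℕ → ℕ} → f ≗ h → ∀ {t} → Continues f t → Continues h t
Continues-resp-≗ f≗h {zero}  c = trans (sym (f≗h zero)) c
Continues-resp-≗ f≗h {suc t} c = trans (sym (f≗h (suc t))) (trans c (cong suc (f≗h t)))

continues⇒run : ∀ {g : ℕ → ℕ} u s → (∀ m → u < m → m ≤ u + s → Continues g m) → g (u + s) ≡ g u + s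
continues⇒run {g} u zero    _ = trans (cong g (+-identityʳ u)) (sym (+-identityʳ (g u)))
continues⇒run {g} u (suc s) c = begin
  g (u + suc s)      ≡⟨ cong g (+-suc u s) ⟩
  g (suc (u + s))    ≡⟨ c (suc (u + s)) (s≤s (m≤m+n u s)) (≤-reflexive (sym (+-suc u s))) ⟩
  suc (g (u + s))    ≡⟨ cong suc (continues⇒run u s λ m u<m m≤ → c m u<m (≤-trans m≤ (+-monoʳ-≤ u (n≤1+n s)))) ⟩
  suc (g u + s)      ≡⟨ sym (+-suc (g u) s) ⟩
  g u + suc s        ∎
  where open ≡-Reasoning

continues⇒fixed-prefix : ∀ {g : ℕ → ℕ} x → (∀ m → m < x → Continues g m) → ∀ t → t < x → g t ≡ t
continues⇒fixed-prefix x c zero    0<x   = c zero 0<x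
continues⇒fixed-prefix x c (suc t) t+1<x =
  trans (c (suc t) t+1<x) (cong suc (continues⇒fixed-prefix x c t (<-trans (n<1+n t) t+1<x)))

fixed-prefix⇒continuation : ∀ {g : ℕ → ℕ} x → (∀ t → t < x → g t ≡ t) → continuation g x ≡ x
fixed-prefix⇒continuation zero    _   = refl
fixed-prefix⇒continuation (suc x) fix = cong suc (fix x (n<1+n x))

run⇒continuation : ∀ {g : ℕ → ℕ} x v l → 0 < l → (∀ s → s < l → g (x + s) ≡ v + s) →
  continuation g (x + l) ≡ v + l
run⇒continuation {g} x v (suc l) _ run = begin
  continuation g (x + suc l)  ≡⟨ cong (continuation g) (+-suc x l) ⟩
  suc (g (x + l))             ≡⟨ cong suc (run l (n<1+n l)) ⟩
  suc (v + l)                 ≡⟨ sym (+-suc v l) ⟩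
  v + suc l                   ∎
  where open ≡-Reasoning

run⇒continues : ∀ {g : ℕ → ℕ} x v s → 0 < s → (∀ r → r ≤ s → g (x + r) ≡ v + r) → Continues g (x + s)
run⇒continues x v s 0<s run =
  trans (run s ≤-refl) (sym (run⇒continuation x v s 0<s λ r r<s → run r (<⇒≤ r<s)))

fixed-prefix⇒continues : ∀ {g : ℕ → ℕ} x → (∀ t → t < x → g t ≡ t) → ∀ t → t < x → Continues g t
fixed-prefix⇒continues x fix t t<x =
  trans (fix t t<x) (sym (fixed-prefix⇒continuation t λ s s<t → fix s (<-trans s<t t<x)))

fixed-suffix⇒continues : ∀ {g : ℕ → ℕ} x → (∀ t → x ≤ t → g t ≡ t) → ∀ t → x < t → Continues g t
fixed-suffix⇒continues x fix (suc t) (s≤s x≤t) =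
  trans (fix (suc t) (m≤n⇒m≤1+n x≤t)) (cong suc (sym (fix t x≤t)))

Among : ℕ → ℕ → ℕ → ℕ → Set
Among t x y z = t ≡ x ⊎ t ≡ y ⊎ t ≡ z

pattern is-1st = inj₁ refl
pattern is-2nd = inj₂ (inj₁ refl)
pattern is-3rd = inj₂ (inj₂ refl)

among-⊆ : ∀ {u v w x y z t} → Among u x y z → Among v x y z → Among w x y z → Among t u v w → Among t x y z
among-⊆ u∈ _  _  is-1st = u∈
among-⊆ _  v∈ _  is-2nd = v∈
among-⊆ _  _  w∈ is-3rd = w∈

among? : ∀ t x y z → Dec (Among t x y z)
among? t x y z with t ≟ x | t ≟ y | t ≟ z
... | yes t≡x | _       | _       = yes (inj₁ t≡x)
... | no _    | yes t≡y | _       = yes (inj₂ (inj₁ t≡y))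
... | no _    | no _    | yes t≡z = yes (inj₂ (inj₂ t≡z))
... | no t≢x  | no t≢y  | no t≢z  = no λ { (inj₁ e) → t≢x e ; (inj₂ (inj₁ e)) → t≢y e ; (inj₂ (inj₂ e)) → t≢z e }

module _ {x y z : ℕ} (x<y : x < y) (y<z : y < z) where

  among-≥ : ∀ {t} → Among t x y z → x ≤ t
  among-≥ is-1st = ≤-refl
  among-≥ is-2nd = <⇒≤ x<y
  among-≥ is-3rd = <⇒≤ (<-trans x<y y<z)

  among-≤ : ∀ {t} → Among t x y z → t ≤ z
  among-≤ is-1st = <⇒≤ (<-trans x<y y<z)
  among-≤ is-2nd = <⇒≤ y<z
  among-≤ is-3rd = ≤-refl

  among-below : ∀ {t} → t < y → Among t x y z → t ≡ x
  among-below _   (inj₁ t≡x) = t≡x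
  among-below t<y is-2nd     = ⊥-elim (<-irrefl refl t<y)
  among-below t<y is-3rd     = ⊥-elim (<-asym t<y y<z)

  among-above : ∀ {t} → y < t → Among t x y z → t ≡ z
  among-above y<t is-1st            = ⊥-elim (<-asym y<t x<y)
  among-above y<t is-2nd            = ⊥-elim (<-irrefl refl y<t)
  among-above _   (inj₂ (inj₂ t≡z)) = t≡z

  among-between : ∀ {t} → x < t → t < z → Among t x y z → t ≡ y
  among-between x<t _   is-1st            = ⊥-elim (<-irrefl refl x<t)
  among-between _   _   (inj₂ (inj₁ t≡y)) = t≡y
  among-between _   t<z is-3rd            = ⊥-elim (<-irrefl refl t<z)

among-sorted : ∀ {x y z d r f} → x < y → y < z → d < r → r < f →
  Among x d r f → Among y d r f → Among z d r f → x ≡ d × y ≡ r × z ≡ f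
among-sorted {x} {y} {z} {d} {r} {f} x<y y<z d<r r<f x∈ y∈ z∈ = x≡d , y≡r , z≡f
  where
  y≡r : y ≡ r
  y≡r = among-between d<r r<f (≤-<-trans (among-≥ d<r r<f x∈) x<y) (<-≤-trans y<z (among-≤ d<r r<f z∈)) y∈
  x≡d : x ≡ d
  x≡d = among-below d<r r<f (subst (_ <_) y≡r x<y) x∈
  z≡f : z ≡ f
  z≡f = among-above d<r r<f (subst (_< _) y≡r y<z) z∈

data Sorting (u v w : ℕ) : Set where
  sorting : ∀ {x y z} → x < y → y < z → Among u x y z → Among v x y z → Among w x y z →
    Among x u v w → Among z u v w → Sorting u v w

sort : ∀ {u v w} → u ≢ v → v ≢ w → u ≢ w → Sorting u v w
sort {u} {v} {w} u≢v v≢w u≢w with <-cmp u v | <-cmp v w | <-cmp u w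
... | tri≈ _ u≡v _ | _            | _            = ⊥-elim (u≢v u≡v)
... | _            | tri≈ _ v≡w _ | _            = ⊥-elim (v≢w v≡w)
... | _            | _            | tri≈ _ u≡w _ = ⊥-elim (u≢w u≡w)
... | tri< u<v _ _ | tri< v<w _ _ | _            = sorting u<v v<w is-1st is-2nd is-3rd is-1st is-3rd
... | tri< _ _ _   | tri> _ _ w<v | tri< u<w _ _ = sorting u<w w<v is-1st is-3rd is-2nd is-1st is-2nd
... | tri< u<v _ _ | tri> _ _ _   | tri> _ _ w<u = sorting w<u u<v is-2nd is-3rd is-1st is-3rd is-2nd
... | tri> _ _ v<u | tri< _ _ _   | tri< u<w _ _ = sorting v<u u<w is-2nd is-1st is-3rd is-2nd is-3rd
... | tri> _ _ _   | tri< v<w _ _ | tri> _ _ w<u = sorting v<w w<u is-3rd is-1st is-2nd is-2nd is-1st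
... | tri> _ _ v<u | tri> _ _ w<v | _            = sorting w<v v<u is-3rd is-2nd is-1st is-3rd is-1st

data Region (x y z : ℕ) : ℕ → Set where
  before : ∀ {t} → t < x → Region x y z t
  first  : ∀ s → x + s < y → Region x y z (x + s)
  second : ∀ s → y + s < z → Region x y z (y + s)
  after  : ∀ {t} → z ≤ t → Region x y z t

region : ∀ x y z t → Region x y z t
region x y z t with t <? x | t <? y | t <? z
... | yes t<x | _       | _       = before t<x
... | no t≮x  | yes t<y | _       =
  let e = m+[n∸m]≡n (≮⇒≥ t≮x) in subst (Region x y z) e (first (t ∸ x) (subst (_< y) (sym e) t<y))
... | no _    | no t≮y  | yes t<z =
  let e = m+[n∸m]≡n (≮⇒≥ t≮y) in subst (Region x y z) e (second (t ∸ y) (subst (_< z) (sym e) t<z))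
... | no _    | no _    | no t≮z  = after (≮⇒≥ t≮z)

-- Block transpositions as functions on ℕ

-- The shape of a block transposition with breakpoints x < y < z: the run cut off at x resumes at y,
-- the one cut off at y resumes at z, and the one cut off at z resumes at x.
record ThreeBlocks (g : ℕ → ℕ) (x y z : ℕ) : Set where
  field
    x<y       : x < y
    y<z       : y < z
    injective : ∀ {t u} → g t ≡ g u → t ≡ u
    continues : ∀ t → ¬ Among t x y z → Continues g t
    glue-x    : continuation g x ≡ g y
    glue-y    : continuation g y ≡ g z
    glue-z    : continuation g z ≡ g x

  x<z : x < z
  x<z = <-trans x<y y<z

  breaks-x : ¬ Continues g x
  breaks-x c = <-irrefl (injective (trans c glue-x)) x<y

  breaks-y : ¬ Continues g y
  breaks-y c = <-irrefl (injective (trans c glue-y)) y<z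

  breaks-z : ¬ Continues g z
  breaks-z c = <-irrefl (sym (injective (trans c glue-z))) x<z

  breaks : ∀ {t} → Among t x y z → ¬ Continues g t
  breaks is-1st = breaks-x
  breaks is-2nd = breaks-y
  breaks is-3rd = breaks-z

  breakpoint-among : ∀ {t} → ¬ Continues g t → Among t x y z
  breakpoint-among {t} b with among? t x y z
  ... | yes t∈ = t∈
  ... | no t∉  = ⊥-elim (b (continues t t∉))

  continued-at : ∀ {u v} → g v ≡ continuation g u →
    (u ≡ x × v ≡ y) ⊎ (u ≡ y × v ≡ z) ⊎ (u ≡ z × v ≡ x) ⊎ v ≡ u
  continued-at {u} {v} gv≡ with among? u x y z
  ... | yes is-1st = inj₁ (refl , injective (trans gv≡ glue-x))
  ... | yes is-2nd = inj₂ (inj₁ (refl , injective (trans gv≡ glue-y)))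
  ... | yes is-3rd = inj₂ (inj₂ (inj₁ (refl , injective (trans gv≡ glue-z))))
  ... | no u∉      = inj₂ (inj₂ (inj₂ (injective (trans gv≡ (sym (continues u u∉))))))

-- σ(i, j, k) moves the block [j, k) in front of [i, j), which then starts at pivot i j k. The
-- breakpoints of σ(i, j, k) are i, pivot i j k and k, and its inverse is σ(i, pivot i j k, k).
pivot : ℕ → ℕ → ℕ → ℕ
pivot i j k = i + (k ∸ j)

btVal-before : ∀ {i j k t} → t < i → btVal i j k t ≡ t
btVal-before {i} {j} {k} {t} t<i with t <? i
... | yes _   = refl
... | no t≮i = ⊥-elim (t≮i t<i)

btVal-first : ∀ {i j k s} → i + s < pivot i j k → btVal i j k (i + s) ≡ j + s
btVal-first {i} {j} {k} {s} i+s<p with i + s <? i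
... | yes i+s<i = ⊥-elim (m+n≮m i s i+s<i)
... | no _ with i + s <? i + (k ∸ j)
...   | yes _ = cong (j +_) (m+n∸m≡n i s)
...   | no ≮p = ⊥-elim (≮p i+s<p)

btVal-second : ∀ {i j k s} → pivot i j k + s < k → btVal i j k (pivot i j k + s) ≡ i + s
btVal-second {i} {j} {k} {s} p+s<k with i + (k ∸ j) + s <? i
... | yes p+s<i = ⊥-elim (<⇒≱ p+s<i (≤-trans (m≤m+n i (k ∸ j)) (m≤m+n _ s)))
... | no _ with i + (k ∸ j) + s <? i + (k ∸ j)
...   | yes p+s<p = ⊥-elim (m+n≮m _ s p+s<p)
...   | no _ with i + (k ∸ j) + s <? k
...     | no ≮k = ⊥-elim (≮k p+s<k)
...     | yes _ = begin
  i + (k ∸ j) + s ∸ (k ∸ j)    ≡⟨ +-∸-comm s (m≤n+m (k ∸ j) i) ⟩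
  i + (k ∸ j) ∸ (k ∸ j) + s    ≡⟨ cong (_+ s) (m+n∸n≡m i (k ∸ j)) ⟩
  i + s                        ∎
  where open ≡-Reasoning

btVal-after : ∀ {i j k t} → i ≤ j → j ≤ k → k ≤ t → btVal i j k t ≡ t
btVal-after {i} {j} {k} {t} i≤j j≤k k≤t with t <? i
... | yes _ = refl
... | no _ with t <? i + (k ∸ j)
...   | yes t<p = ⊥-elim (<⇒≱ t<p (≤-trans p≤k k≤t))
  where
  p≤k : pivot i j k ≤ k
  p≤k = ≤-trans (+-monoˡ-≤ (k ∸ j) i≤j) (≤-reflexive (m+[n∸m]≡n j≤k))
...   | no _ with t <? k
...     | yes t<k = ⊥-elim (<⇒≱ t<k k≤t)
...     | no _    = refl

module BlockTransposition {i j k : ℕ} (i<j : i < j) (j<k : j < k) where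

  private
    g : ℕ → ℕ
    g = btVal i j k
    d e q : ℕ
    d = k ∸ j
    e = j ∸ i
    q = pivot i j k

  i+e≡j : i + e ≡ j
  i+e≡j = m+[n∸m]≡n (<⇒≤ i<j)

  j+d≡k : j + d ≡ k
  j+d≡k = m+[n∸m]≡n (<⇒≤ j<k)

  q+e≡k : q + e ≡ k
  q+e≡k = begin
    i + d + e  ≡⟨ +-assoc i d e ⟩
    i + (d + e) ≡⟨ cong (i +_) (+-comm d e) ⟩
    i + (e + d) ≡⟨ sym (+-assoc i e d) ⟩
    i + e + d  ≡⟨ cong (_+ d) i+e≡j ⟩
    j + d      ≡⟨ j+d≡k ⟩
    k          ∎
    where open ≡-Reasoning

  pivot-pivot : pivot i q k ≡ j
  pivot-pivot = trans (cong (λ m → i + (m ∸ q)) (sym q+e≡k)) (trans (cong (i +_) (m+n∸m≡n q e)) i+e≡j)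

  0<d : 0 < d
  0<d = m<n⇒0<n∸m j<k

  0<e : 0 < e
  0<e = m<n⇒0<n∸m i<j

  i<q : i < q
  i<q = m<m+n i 0<d

  q<k : q < k
  q<k = subst (q <_) q+e≡k (m<m+n q 0<e)

  first-block : ∀ s → s < d → g (i + s) ≡ j + s
  first-block s s<d = btVal-first {i} {j} {k} (+-monoʳ-< i s<d)

  second-block : ∀ s → s < e → g (q + s) ≡ i + s
  second-block s s<e = btVal-second {i} {j} {k} (subst (q + s <_) q+e≡k (+-monoʳ-< q s<e))

  fixes : ∀ t → k ≤ t → g t ≡ t
  fixes t = btVal-after {i} {j} {k} (<⇒≤ i<j) (<⇒≤ j<k)

  at-i : g i ≡ j
  at-i = trans (cong g (sym (+-identityʳ i))) (trans (first-block 0 0<d) (+-identityʳ j))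

  at-pivot : g q ≡ i
  at-pivot = trans (cong g (sym (+-identityʳ q))) (trans (second-block 0 0<e) (+-identityʳ i))

  at-k : g k ≡ k
  at-k = fixes k ≤-refl

  before-fixed : ∀ t → t < i → g t ≡ t
  before-fixed t = btVal-before {i} {j} {k}

  glue-i : continuation g i ≡ g q
  glue-i = trans (fixed-prefix⇒continuation i before-fixed) (sym at-pivot)

  glue-q : continuation g q ≡ g k
  glue-q = trans (run⇒continuation i j d 0<d first-block) (trans j+d≡k (sym at-k))

  glue-k : continuation g k ≡ g i
  glue-k = begin
    continuation g k        ≡⟨ cong (continuation g) (sym q+e≡k) ⟩
    continuation g (q + e)  ≡⟨ run⇒continuation q i e 0<e second-block ⟩
    i + e                   ≡⟨ i+e≡j ⟩
    j                       ≡⟨ sym at-i ⟩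
    g i                     ∎
    where open ≡-Reasoning

  continues : ∀ t → ¬ Among t i q k → Continues g t
  continues t t∉ with region i q k t
  ... | before t<i           = fixed-prefix⇒continues i before-fixed t t<i
  ... | first zero _         = ⊥-elim (t∉ (inj₁ (+-identityʳ i)))
  ... | first (suc s) i+s<q  =
    run⇒continues i j (suc s) z<s λ r r≤ → first-block r (≤-<-trans r≤ (+-cancelˡ-< i _ d i+s<q))
  ... | second zero _        = ⊥-elim (t∉ (inj₂ (inj₁ (+-identityʳ q))))
  ... | second (suc s) q+s<k =
    run⇒continues q i (suc s) z<s λ r r≤ →
      second-block r (≤-<-trans r≤ (+-cancelˡ-< q _ e (subst (q + suc s <_) (sym q+e≡k) q+s<k)))
  ... | after k≤t with m≤n⇒m<n∨m≡n k≤t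
  ...   | inj₁ k<t  = fixed-suffix⇒continues k fixes t k<t
  ...   | inj₂ refl = ⊥-elim (t∉ (inj₂ (inj₂ refl)))

  inverse : ∀ t → btVal i q k (g t) ≡ t
  inverse t with region i q k t
  ... | before t<i = trans (cong (btVal i q k) (before-fixed t t<i)) (btVal-before {i} {q} {k} t<i)
  ... | first s i+s<q = begin
    btVal i q k (g (i + s))          ≡⟨ cong (btVal i q k) (first-block s s<d) ⟩
    btVal i q k (j + s)              ≡⟨ cong (λ m → btVal i q k (m + s)) (sym pivot-pivot) ⟩
    btVal i q k (pivot i q k + s)    ≡⟨ btVal-second {i} {q} {k} (subst (_< k) (cong (_+ s) (sym pivot-pivot)) j+s<k) ⟩
    i + s                            ∎
    where
    open ≡-Reasoning
    s<d : s < d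
    s<d = +-cancelˡ-< i s d i+s<q
    j+s<k : j + s < k
    j+s<k = subst (j + s <_) j+d≡k (+-monoʳ-< j s<d)
  ... | second s q+s<k = begin
    btVal i q k (g (q + s))  ≡⟨ cong (btVal i q k) (second-block s s<e) ⟩
    btVal i q k (i + s)      ≡⟨ btVal-first {i} {q} {k} (subst (i + s <_) (sym pivot-pivot) i+s<j) ⟩
    q + s                    ∎
    where
    open ≡-Reasoning
    s<e : s < e
    s<e = +-cancelˡ-< q s e (subst (q + s <_) (sym q+e≡k) q+s<k)
    i+s<j : i + s < j
    i+s<j = subst (i + s <_) i+e≡j (+-monoʳ-< i s<e)
  ... | after k≤t = trans (cong (btVal i q k) (fixes t k≤t)) (btVal-after {i} {q} {k} (<⇒≤ i<q) (<⇒≤ q<k) k≤t)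

  injective : ∀ {t u} → g t ≡ g u → t ≡ u
  injective {t} {u} gt≡gu = trans (sym (inverse t)) (trans (cong (btVal i q k) gt≡gu) (inverse u))

  bounded : ∀ {n} t → k ≤ n → t < n → g t < n
  bounded {n} t k≤n t<n with g t <? n
  ... | yes gt<n = gt<n
  ... | no gt≮n  = ⊥-elim (<⇒≱ t<n (subst (n ≤_) (injective (fixes (g t) (≤-trans k≤n n≤gt))) n≤gt))
    where
    n≤gt : n ≤ g t
    n≤gt = ≮⇒≥ gt≮n

  threeBlocks : ThreeBlocks g i q k
  threeBlocks = record
    { x<y = i<q ; y<z = q<k ; injective = injective ; continues = continues
    ; glue-x = glue-i ; glue-y = glue-q ; glue-z = glue-k }

btVal-inverseʳ : ∀ {i j k} → i < j → j < k → ∀ v → btVal i j k (btVal i (pivot i j k) k v) ≡ v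
btVal-inverseʳ {i} {j} {k} i<j j<k v =
  subst (λ m → btVal i m k (btVal i (pivot i j k) k v) ≡ v) pivot-pivot (Inverse.inverse v)
  where
  open BlockTransposition i<j j<k using (i<q; q<k; pivot-pivot)
  module Inverse = BlockTransposition i<q q<k

btVal-≗⇒≡ : ∀ {a b c a′ b′ c′} → a < b → b < c → a′ < b′ → b′ < c′ →
  btVal a b c ≗ btVal a′ b′ c′ → (a , b , c) ≡ (a′ , b′ , c′)
btVal-≗⇒≡ {a} {b} {c} {a′} {b′} {c′} a<b b<c a′<b′ b′<c′ τ≗τ′
  with among-sorted τ³.x<y τ³.y<z τ′³.x<y τ′³.y<z (moved τ³.breaks-x) (moved τ³.breaks-y) (moved τ³.breaks-z)
  where
  module τ = BlockTransposition a<b b<c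
  module τ′ = BlockTransposition a′<b′ b′<c′
  module τ³ = ThreeBlocks τ.threeBlocks
  module τ′³ = ThreeBlocks τ′.threeBlocks
  moved : ∀ {t} → ¬ Continues (btVal a b c) t → Among t a′ (pivot a′ b′ c′) c′
  moved t-breaks = τ′³.breakpoint-among (t-breaks ∘ Continues-resp-≗ (sym ∘ τ≗τ′))
... | refl , _ , refl = cong (λ m → a , m , c) b≡b′
  where
  b≡b′ : b ≡ b′
  b≡b′ = trans (sym (BlockTransposition.at-i a<b b<c)) (trans (τ≗τ′ a) (BlockTransposition.at-i a′<b′ b′<c′))

-- Recognising block transpositions by their breakpoints

IsBlockTransposition : ℕ → (ℕ → ℕ) → Set
IsBlockTransposition N g = Σ ℕ λ d → Σ ℕ λ e → Σ ℕ λ f → d < e × e < f × f ≤ N × g ≗ btVal d e f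

record IsPermutationBelow (N : ℕ) (g : ℕ → ℕ) : Set where
  field
    injective  : ∀ {t u} → g t ≡ g u → t ≡ u
    surjective : ∀ v → Σ ℕ λ t → g t ≡ v
    fixes      : ∀ t → N ≤ t → g t ≡ t

≤-+-antisym : ∀ {m n o} → m ≤ n → n + o ≡ m → n ≡ m
≤-+-antisym {m} {n} {o} m≤n n+o≡m = ≤-antisym (subst (n ≤_) n+o≡m (m≤m+n n o)) m≤n

-- g is a translation on each of [0, x), [x, y), [y, z) and [z, ∞), the first and last fixed;
-- locating the preimages of x and of x + (z − y) then forces g y = x and g x = x + (z − y).
module Characterisation {g : ℕ → ℕ} {N x y z : ℕ} (perm : IsPermutationBelow N g) (x<y : x < y) (y<z : y < z)
  (breaks-x : ¬ Continues g x) (breaks-z : ¬ Continues g z) (continues : ∀ t → ¬ Among t x y z → Continues g t)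
  where

  open IsPermutationBelow perm

  private
    E : ℕ
    E = pivot x y z
    open BlockTransposition x<y y<z using (pivot-pivot) renaming (i<q to x<E; q<k to E<z)

  fixed-before : ∀ t → t < x → g t ≡ t
  fixed-before = continues⇒fixed-prefix x λ m m<x → continues m λ m∈ → <⇒≱ m<x (among-≥ x<y y<z m∈)

  first-run : ∀ s → x + s < y → g (x + s) ≡ g x + s
  first-run s x+s<y = continues⇒run x s λ m x<m m≤ → continues m λ m∈ →
    <-irrefl (among-between x<y y<z x<m (<-trans (≤-<-trans m≤ x+s<y) y<z) m∈) (≤-<-trans m≤ x+s<y)

  second-run : ∀ s → y + s < z → g (y + s) ≡ g y + s
  second-run s y+s<z = continues⇒run y s λ m y<m m≤ → continues m λ m∈ →
    <-irrefl (among-above x<y y<z y<m m∈) (≤-<-trans m≤ y+s<z)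

  last-run : ∀ s → g (z + s) ≡ g z + s
  last-run s = continues⇒run z s λ m z<m _ → continues m λ m∈ → <⇒≱ z<m (among-≤ x<y y<z m∈)

  at-z : g z ≡ z
  at-z = +-cancelʳ-≡ N (g z) z (trans (sym (last-run N)) (fixes (z + N) (m≤n+m N z)))

  fixed-after : ∀ t → z ≤ t → g t ≡ t
  fixed-after t z≤t = subst (λ m → g m ≡ m) (m+[n∸m]≡n z≤t) (trans (last-run (t ∸ z)) (cong (_+ (t ∸ z)) at-z))

  z≤N : z ≤ N
  z≤N with z ≤? N
  ... | yes z≤N = z≤N
  ... | no z≰N  = ⊥-elim (breaks-z (fixed-suffix⇒continues N fixes z (≰⇒> z≰N)))

  x≤g : ∀ v → x ≤ v → x ≤ g v
  x≤g v x≤v with g v <? x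
  ... | no gv≮x = ≮⇒≥ gv≮x
  ... | yes gv<x = ⊥-elim (<⇒≱ gv<x (subst (x ≤_) (sym (injective (fixed-before (g v) gv<x))) x≤v))

  at-y : g y ≡ x
  at-y with surjective x
  ... | t , gt≡x with region x y z t
  ...   | before t<x = ⊥-elim (<-irrefl (trans (sym (fixed-before t t<x)) gt≡x) t<x)
  ...   | first s x+s<y = ⊥-elim (breaks-x (trans gx≡x (sym (fixed-prefix⇒continuation x fixed-before))))
    where
    gx≡x : g x ≡ x
    gx≡x = ≤-+-antisym (x≤g x ≤-refl) (trans (sym (first-run s x+s<y)) gt≡x)
  ...   | second s y+s<z = ≤-+-antisym (x≤g y (<⇒≤ x<y)) (trans (sym (second-run s y+s<z)) gt≡x)
  ...   | after z≤t = ⊥-elim (<⇒≱ (<-trans x<y y<z) (subst (z ≤_) (trans (sym (fixed-after t z≤t)) gt≡x) z≤t))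

  E≤gx : E ≤ g x
  E≤gx with E ≤? g x
  ... | yes E≤gx = E≤gx
  ... | no E≰gx  = ⊥-elim (<⇒≱ (<-≤-trans x<y (m≤m+n y r)) (≤-reflexive (injective g[y+r]≡gx)))
    where
    r : ℕ
    r = g x ∸ x
    x+r≡gx : x + r ≡ g x
    x+r≡gx = m+[n∸m]≡n (x≤g x ≤-refl)
    y+r<z : y + r < z
    y+r<z = subst (y + r <_) (m+[n∸m]≡n (<⇒≤ y<z))
              (+-monoʳ-< y (+-cancelˡ-< x r (z ∸ y) (subst (_< E) (sym x+r≡gx) (≰⇒> E≰gx))))
    g[y+r]≡gx : g (y + r) ≡ g x
    g[y+r]≡gx = trans (second-run r y+r<z) (trans (cong (_+ r) at-y) x+r≡gx)

  at-x : g x ≡ E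
  at-x with surjective E
  ... | t , gt≡E with region x y z t
  ...   | before t<x =
    ⊥-elim (<⇒≱ t<x (subst (x ≤_) (sym (trans (sym (fixed-before t t<x)) gt≡E)) (m≤m+n x (z ∸ y))))
  ...   | first s x+s<y = ≤-antisym (subst (g x ≤_) gx+s≡E (m≤m+n (g x) s)) E≤gx
    where
    gx+s≡E : g x + s ≡ E
    gx+s≡E = trans (sym (first-run s x+s<y)) gt≡E
  ...   | second s y+s<z = ⊥-elim (<-irrefl y+s≡z y+s<z)
    where
    s≡z∸y : s ≡ z ∸ y
    s≡z∸y = +-cancelˡ-≡ x s (z ∸ y) (trans (cong (_+ s) (sym at-y)) (trans (sym (second-run s y+s<z)) gt≡E))
    y+s≡z : y + s ≡ z
    y+s≡z = trans (cong (y +_) s≡z∸y) (m+[n∸m]≡n (<⇒≤ y<z))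
  ...   | after z≤t = ⊥-elim (<⇒≱ E<z (subst (z ≤_) (trans (sym (fixed-after t z≤t)) gt≡E) z≤t))

  formula : g ≗ btVal x E z
  formula t with region x y z t
  ... | before t<x = trans (fixed-before t t<x) (sym (btVal-before t<x))
  ... | first s x+s<y = begin
    g (x + s)           ≡⟨ first-run s x+s<y ⟩
    g x + s             ≡⟨ cong (_+ s) at-x ⟩
    E + s               ≡⟨ sym (btVal-first {x} {E} {z} (subst (x + s <_) (sym pivot-pivot) x+s<y)) ⟩
    btVal x E z (x + s) ∎
    where open ≡-Reasoning
  ... | second s y+s<z = begin
    g (y + s)                     ≡⟨ second-run s y+s<z ⟩
    g y + s                       ≡⟨ cong (_+ s) at-y ⟩
    x + s                         ≡⟨ sym (btVal-second {x} {E} {z} (subst (λ m → m + s < z) (sym pivot-pivot) y+s<z)) ⟩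
    btVal x E z (pivot x E z + s) ≡⟨ cong (λ m → btVal x E z (m + s)) pivot-pivot ⟩
    btVal x E z (y + s)           ∎
    where open ≡-Reasoning
  ... | after z≤t = trans (fixed-after t z≤t) (sym (btVal-after (<⇒≤ x<E) (<⇒≤ E<z) z≤t))

  isBlockTransposition : IsBlockTransposition N g
  isBlockTransposition = x , E , z , x<E , E<z , z≤N , formula

three-breakpoints⇒isBlockTransposition : ∀ {N g u v w} → IsPermutationBelow N g →
  u ≢ v → v ≢ w → u ≢ w → (∀ {t} → Among t u v w → ¬ Continues g t) →
  (∀ t → ¬ Among t u v w → Continues g t) → IsBlockTransposition N g
three-breakpoints⇒isBlockTransposition perm u≢v v≢w u≢w breaks continues
  with sort u≢v v≢w u≢w
... | sorting x<y y<z u∈ v∈ w∈ x∈ z∈ = Characterisation.isBlockTransposition perm x<y y<z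
  (breaks x∈) (breaks z∈) (λ t t∉ → continues t (t∉ ∘ among-⊆ u∈ v∈ w∈))

-- Composing two block transpositions

Continues-∘⇔ : ∀ (g f : ℕ → ℕ) {t u v} → f t ≡ v → continuation f t ≡ u →
  Continues (g ∘ f) t ⇔ g v ≡ continuation g u
Continues-∘⇔ g f {t} refl refl =
  mk⇔ (λ c → trans c (continuation-∘ g f t)) (λ e → trans e (sym (continuation-∘ g f t)))

isBlockTransposition⇒≉id : ∀ {N h} → IsBlockTransposition N h → ¬ (h ≗ id)
isBlockTransposition⇒≉id (d , e , f , d<e , e<f , _ , h≗σ) h≗id =
  ThreeBlocks.breaks-x (BlockTransposition.threeBlocks d<e e<f)
    (Continues-resp-≗ (λ t → trans (sym (h≗id t)) (h≗σ t)) (continues-id d))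

module Composition {i j k a b c : ℕ} (i<j : i < j) (j<k : j < k) (a<b : a < b) (b<c : b < c) where

  private
    W τ τ⁻¹ : ℕ → ℕ
    W = btVal i j k
    τ = btVal a b c
    q p : ℕ
    q = pivot i j k
    p = pivot a b c
    τ⁻¹ = btVal a p c
    module W = BlockTransposition i<j j<k
    module τ = BlockTransposition a<b b<c
    module W³ = ThreeBlocks W.threeBlocks
    module τ³ = ThreeBlocks τ.threeBlocks

    ττ⁻¹ : ∀ v → τ (τ⁻¹ v) ≡ v
    ττ⁻¹ = btVal-inverseʳ a<b b<c

    glued-at-a : Continues (W ∘ τ) a ⇔ W b ≡ continuation W a
    glued-at-a = Continues-∘⇔ W τ τ.at-i (trans τ³.glue-x τ.at-pivot)

    glued-at-p : Continues (W ∘ τ) p ⇔ W a ≡ continuation W c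
    glued-at-p = Continues-∘⇔ W τ τ.at-pivot (trans τ³.glue-y τ.at-k)

    glued-at-c : Continues (W ∘ τ) c ⇔ W c ≡ continuation W b
    glued-at-c = Continues-∘⇔ W τ τ.at-k (trans τ³.glue-z τ.at-i)

  continues-off : ∀ {t} → ¬ Among t a p c → Continues (W ∘ τ) t ⇔ Continues W (τ t)
  continues-off {t} t∉ = Continues-∘⇔ W τ refl (sym (τ³.continues t t∉))

  continues-at-a⇔ : Continues (W ∘ τ) a ⇔ ((a ≡ i × b ≡ q) ⊎ (a ≡ q × b ≡ k))
  continues-at-a⇔ = mk⇔ (cases ∘ Equivalence.to glued-at-a) (Equivalence.from glued-at-a ∘ glue)
    where
    cases : W b ≡ continuation W a → (a ≡ i × b ≡ q) ⊎ (a ≡ q × b ≡ k)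
    cases glued with W³.continued-at glued
    ... | inj₁ a,b                         = inj₁ a,b
    ... | inj₂ (inj₁ a,b)                  = inj₂ a,b
    ... | inj₂ (inj₂ (inj₁ (refl , refl))) = ⊥-elim (<-asym a<b W³.x<z)
    ... | inj₂ (inj₂ (inj₂ refl))          = ⊥-elim (<-irrefl refl a<b)
    glue : (a ≡ i × b ≡ q) ⊎ (a ≡ q × b ≡ k) → W b ≡ continuation W a
    glue (inj₁ (refl , refl)) = sym W³.glue-x
    glue (inj₂ (refl , refl)) = sym W³.glue-y

  continues-at-p⇔ : Continues (W ∘ τ) p ⇔ (a ≡ i × c ≡ k)
  continues-at-p⇔ = mk⇔ (cases ∘ Equivalence.to glued-at-p) (Equivalence.from glued-at-p ∘ glue)
    where
    cases : W a ≡ continuation W c → a ≡ i × c ≡ k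
    cases glued with W³.continued-at glued
    ... | inj₁ (refl , refl)             = ⊥-elim (<-asym (<-trans a<b b<c) W.i<q)
    ... | inj₂ (inj₁ (refl , refl))      = ⊥-elim (<-asym (<-trans a<b b<c) W.q<k)
    ... | inj₂ (inj₂ (inj₁ (c≡k , a≡i))) = a≡i , c≡k
    ... | inj₂ (inj₂ (inj₂ refl))        = ⊥-elim (<-irrefl refl (<-trans a<b b<c))
    glue : a ≡ i × c ≡ k → W a ≡ continuation W c
    glue (refl , refl) = sym W³.glue-z

  continues-at-c⇔ : Continues (W ∘ τ) c ⇔ ((b ≡ i × c ≡ q) ⊎ (b ≡ q × c ≡ k))
  continues-at-c⇔ = mk⇔ (cases ∘ Equivalence.to glued-at-c) (Equivalence.from glued-at-c ∘ glue)
    where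
    cases : W c ≡ continuation W b → (b ≡ i × c ≡ q) ⊎ (b ≡ q × c ≡ k)
    cases glued with W³.continued-at glued
    ... | inj₁ b,c                         = inj₁ b,c
    ... | inj₂ (inj₁ b,c)                  = inj₂ b,c
    ... | inj₂ (inj₂ (inj₁ (refl , refl))) = ⊥-elim (<-asym b<c W³.x<z)
    ... | inj₂ (inj₂ (inj₂ refl))          = ⊥-elim (<-irrefl refl b<c)
    glue : (b ≡ i × c ≡ q) ⊎ (b ≡ q × c ≡ k) → W c ≡ continuation W b
    glue (inj₁ (refl , refl)) = sym W³.glue-x
    glue (inj₂ (refl , refl)) = sym W³.glue-y

  inverse-composite : a ≡ i → b ≡ q → c ≡ k → W ∘ τ ≗ id
  inverse-composite refl refl refl = btVal-inverseʳ i<j j<k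

  isPermutationBelow : ∀ {N} → k ≤ N → c ≤ N → IsPermutationBelow N (W ∘ τ)
  isPermutationBelow k≤N c≤N = record
    { injective  = τ.injective ∘ W.injective
    ; surjective = λ v → τ⁻¹ (btVal i q k v) , trans (cong W (ττ⁻¹ _)) (btVal-inverseʳ i<j j<k v)
    ; fixes      = λ t N≤t → trans (cong W (τ.fixes t (≤-trans c≤N N≤t))) (W.fixes t (≤-trans k≤N N≤t))
    }

  private
    τ-among : ∀ {t} → Among t a p c → Among (τ t) a b c
    τ-among is-1st = inj₂ (inj₁ τ.at-i)
    τ-among is-2nd = inj₁ τ.at-pivot
    τ-among is-3rd = inj₂ (inj₂ τ.at-k)

    τ⁻¹-off : ∀ {v} → ¬ Among v a b c → ¬ Among (τ⁻¹ v) a p c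
    τ⁻¹-off v∉ t∈ = v∉ (subst (λ m → Among m a b c) (ττ⁻¹ _) (τ-among t∈))

    τ⁻¹-breaks : ∀ {v} → Among v i q k → ¬ Among v a b c → ¬ Continues (W ∘ τ) (τ⁻¹ v)
    τ⁻¹-breaks v∈ v∉ cont =
      W³.breaks v∈ (subst (Continues W) (ττ⁻¹ _) (Equivalence.to (continues-off (τ⁻¹-off v∉)) cont))

  module _ {N w : ℕ} (k≤N : k ≤ N) (c≤N : c ≤ N)
    (w∈ : Among w i q k) (w∉ : ¬ Among w a b c) (others∈ : ∀ {v} → Among v i q k → v ≢ w → Among v a b c)
    where

    private
      tw : ℕ
      tw = τ⁻¹ w

      tw∉ : ¬ Among tw a p c
      tw∉ = τ⁻¹-off w∉

      τ⁻¹-among : ∀ {t} → Among (τ t) a b c → Among t a p c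
      τ⁻¹-among (inj₁ τt≡a)        = inj₂ (inj₁ (τ.injective (trans τt≡a (sym τ.at-pivot))))
      τ⁻¹-among (inj₂ (inj₁ τt≡b)) = inj₁ (τ.injective (trans τt≡b (sym τ.at-i)))
      τ⁻¹-among (inj₂ (inj₂ τt≡c)) = inj₂ (inj₂ (τ.injective (trans τt≡c (sym τ.at-k))))

      continues-off-apc : ∀ {t} → ¬ Among t a p c → t ≢ tw → Continues (W ∘ τ) t
      continues-off-apc {t} t∉apc t≢tw = Equivalence.from (continues-off t∉apc) (W³.continues (τ t) τt∉)
        where
        τt∉ : ¬ Among (τ t) i q k
        τt∉ τt∈ with τ t ≟ w
        ... | yes τt≡w = t≢tw (τ.injective (trans τt≡w (sym (ττ⁻¹ w))))
        ... | no τt≢w  = t∉apc (τ⁻¹-among (others∈ τt∈ τt≢w))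

      breakpoints : ∀ {u₁ u₂} → Among u₁ a p c → Among u₂ a p c → u₁ ≢ u₂ →
        ¬ Continues (W ∘ τ) u₁ → ¬ Continues (W ∘ τ) u₂ →
        (∀ {t} → Among t a p c → t ≢ u₁ → t ≢ u₂ → Continues (W ∘ τ) t) → IsBlockTransposition N (W ∘ τ)
      breakpoints {u₁} {u₂} u₁∈ u₂∈ u₁≢u₂ u₁-breaks u₂-breaks glued =
        three-breakpoints⇒isBlockTransposition (isPermutationBelow k≤N c≤N)
          u₁≢u₂ (λ { refl → tw∉ u₂∈ }) (λ { refl → tw∉ u₁∈ })
          (λ { is-1st → u₁-breaks ; is-2nd → u₂-breaks ; is-3rd → τ⁻¹-breaks w∈ w∉ })
          continues
        where
        continues : ∀ t → ¬ Among t u₁ u₂ tw → Continues (W ∘ τ) t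
        continues t t∉ with among? t a p c
        ... | yes t∈   = glued t∈ (t∉ ∘ inj₁) (t∉ ∘ inj₂ ∘ inj₁)
        ... | no t∉apc = continues-off-apc t∉apc (t∉ ∘ inj₂ ∘ inj₂)

    glued-at-a⇒isBlockTransposition : Continues (W ∘ τ) a → ¬ Continues (W ∘ τ) p → ¬ Continues (W ∘ τ) c →
      IsBlockTransposition N (W ∘ τ)
    glued-at-a⇒isBlockTransposition a-glued p-breaks c-breaks =
      breakpoints is-2nd is-3rd (<⇒≢ τ.q<k) p-breaks c-breaks
        λ { is-1st _ _ → a-glued ; is-2nd p≢p _ → ⊥-elim (p≢p refl) ; is-3rd _ c≢c → ⊥-elim (c≢c refl) }

    glued-at-p⇒isBlockTransposition : ¬ Continues (W ∘ τ) a → Continues (W ∘ τ) p → ¬ Continues (W ∘ τ) c →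
      IsBlockTransposition N (W ∘ τ)
    glued-at-p⇒isBlockTransposition a-breaks p-glued c-breaks =
      breakpoints is-1st is-3rd (<⇒≢ τ³.x<z) a-breaks c-breaks
        λ { is-1st a≢a _ → ⊥-elim (a≢a refl) ; is-2nd _ _ → p-glued ; is-3rd _ c≢c → ⊥-elim (c≢c refl) }

    glued-at-c⇒isBlockTransposition : ¬ Continues (W ∘ τ) a → ¬ Continues (W ∘ τ) p → Continues (W ∘ τ) c →
      IsBlockTransposition N (W ∘ τ)
    glued-at-c⇒isBlockTransposition a-breaks p-breaks c-glued =
      breakpoints is-1st is-2nd (<⇒≢ τ.i<q) a-breaks p-breaks
        λ { is-1st a≢a _ → ⊥-elim (a≢a refl) ; is-2nd _ p≢p → ⊥-elim (p≢p refl) ; is-3rd _ _ → c-glued }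

  -- If a, p and c all break, they are the breakpoints of W ∘ τ, so τ must send a, p or c to every
  -- breakpoint of W, i.e. {i, q, k} = {a, b, c}.
  all-broken⇒inverse : ∀ {N} → IsBlockTransposition N (W ∘ τ) →
    ¬ Continues (W ∘ τ) a → ¬ Continues (W ∘ τ) p → ¬ Continues (W ∘ τ) c → a ≡ i × b ≡ q × c ≡ k
  all-broken⇒inverse (d , e , f , d<e , e<f , _ , W∘τ≗ρ) a-breaks p-breaks c-breaks
    with among-sorted W.i<q W.q<k a<b b<c (within-abc is-1st) (within-abc is-2nd) (within-abc is-3rd)
    where
    module ρ³ = ThreeBlocks (BlockTransposition.threeBlocks d<e e<f)
    r : ℕ
    r = pivot d e f

    breakpoint-among : ∀ {t} → ¬ Continues (W ∘ τ) t → Among t d r f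
    breakpoint-among t-breaks = ρ³.breakpoint-among (t-breaks ∘ Continues-resp-≗ (sym ∘ W∘τ≗ρ))

    drf⊆apc : ∀ {t} → Among t d r f → Among t a p c
    drf⊆apc with among-sorted τ³.x<y τ³.y<z ρ³.x<y ρ³.y<z
                   (breakpoint-among a-breaks) (breakpoint-among p-breaks) (breakpoint-among c-breaks)
    ... | a≡d , p≡r , c≡f = among-⊆ (inj₁ (sym a≡d)) (inj₂ (inj₁ (sym p≡r))) (inj₂ (inj₂ (sym c≡f)))

    within-abc : ∀ {v} → Among v i q k → Among v a b c
    within-abc {v} v∈ with among? v a b c
    ... | yes v∈abc = v∈abc
    ... | no v∉     = ⊥-elim (τ⁻¹-off v∉ (drf⊆apc (breakpoint-among (τ⁻¹-breaks v∈ v∉))))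
  ... | i≡a , q≡b , k≡c = sym i≡a , sym q≡b , sym k≡c

-- The neighbours of a block transposition

module Neighbours {n i j k : ℕ} (i<j : i < j) (j<k : j < k) (k≤n : k ≤ n) where

  q : ℕ
  q = pivot i j k

  private
    W : ℕ → ℕ
    W = btVal i j k
    module W = BlockTransposition i<j j<k
    module W³ = ThreeBlocks W.threeBlocks
    open Equivalence using (to; from)

  -- The parameters (a, b, c) with σ(i, j, k) ∘ σ(a, b, c) ∈ T_n, in five families named after the
  -- two parameters that coincide with breakpoints of σ(i, j, k).
  data Partner : ℕ × ℕ × ℕ → Set where
    bc≡iq : ∀ {a} → a < i → Partner (a , i , q)
    bc≡qk : ∀ {a} → a < q → a ≢ i → Partner (a , q , k)
    ac≡ik : ∀ {b} → i < b → b < k → b ≢ q → Partner (i , b , k)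
    ab≡iq : ∀ {c} → q < c → c ≤ n → c ≢ k → Partner (i , q , c)
    ab≡qk : ∀ {c} → k < c → c ≤ n → Partner (q , k , c)

  partner-valid : ∀ {a b c} → Partner (a , b , c) → a < b × b < c × c ≤ n
  partner-valid (bc≡iq a<i)        = a<i , W.i<q , ≤-trans (<⇒≤ W.q<k) k≤n
  partner-valid (bc≡qk a<q _)      = a<q , W.q<k , k≤n
  partner-valid (ac≡ik i<b b<k _)  = i<b , b<k , k≤n
  partner-valid (ab≡iq q<c c≤n _)  = W.i<q , q<c , c≤n
  partner-valid (ab≡qk k<c c≤n)    = W.q<k , k<c , c≤n

  partner⇒isBlockTransposition : ∀ {a b c} → Partner (a , b , c) → IsBlockTransposition n (W ∘ btVal a b c)
  partner⇒isBlockTransposition (bc≡iq a<i) =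
    C.glued-at-c⇒isBlockTransposition k≤n (≤-trans (<⇒≤ W.q<k) k≤n) is-3rd
      (λ { (inj₁ refl) → <-asym a<i W³.x<z ; (inj₂ (inj₁ k≡i)) → <-irrefl (sym k≡i) W³.x<z
         ; (inj₂ (inj₂ k≡q)) → <-irrefl (sym k≡q) W.q<k })
      (λ { is-1st _ → is-2nd ; is-2nd _ → is-3rd ; is-3rd k≢k → ⊥-elim (k≢k refl) })
      ((λ { (inj₁ (a≡i , _)) → <-irrefl a≡i a<i ; (inj₂ (_ , i≡k)) → <-irrefl i≡k W³.x<z }) ∘ to C.continues-at-a⇔)
      ((λ (_ , q≡k) → <-irrefl q≡k W.q<k) ∘ to C.continues-at-p⇔)
      (from C.continues-at-c⇔ (inj₁ (refl , refl)))
    where module C = Composition i<j j<k a<i W.i<q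
  partner⇒isBlockTransposition (bc≡qk a<q a≢i) =
    C.glued-at-c⇒isBlockTransposition k≤n k≤n is-1st
      (λ { (inj₁ i≡a) → a≢i (sym i≡a) ; (inj₂ (inj₁ i≡q)) → <-irrefl i≡q W.i<q
         ; (inj₂ (inj₂ i≡k)) → <-irrefl i≡k W³.x<z })
      (λ { is-1st i≢i → ⊥-elim (i≢i refl) ; is-2nd _ → is-2nd ; is-3rd _ → is-3rd })
      ((λ { (inj₁ (a≡i , _)) → a≢i a≡i ; (inj₂ (a≡q , _)) → <-irrefl a≡q a<q }) ∘ to C.continues-at-a⇔)
      ((λ (a≡i , _) → a≢i a≡i) ∘ to C.continues-at-p⇔)
      (from C.continues-at-c⇔ (inj₂ (refl , refl)))
    where module C = Composition i<j j<k a<q W.q<k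
  partner⇒isBlockTransposition (ac≡ik i<b b<k b≢q) =
    C.glued-at-p⇒isBlockTransposition k≤n k≤n is-2nd
      (λ { (inj₁ q≡i) → <-irrefl (sym q≡i) W.i<q ; (inj₂ (inj₁ q≡b)) → b≢q (sym q≡b)
         ; (inj₂ (inj₂ q≡k)) → <-irrefl q≡k W.q<k })
      (λ { is-1st _ → is-1st ; is-2nd q≢q → ⊥-elim (q≢q refl) ; is-3rd _ → is-3rd })
      ((λ { (inj₁ (_ , b≡q)) → b≢q b≡q ; (inj₂ (i≡q , _)) → <-irrefl i≡q W.i<q }) ∘ to C.continues-at-a⇔)
      (from C.continues-at-p⇔ (refl , refl))
      ((λ { (inj₁ (_ , k≡q)) → <-irrefl (sym k≡q) W.q<k ; (inj₂ (b≡q , _)) → b≢q b≡q }) ∘ to C.continues-at-c⇔)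
    where module C = Composition i<j j<k i<b b<k
  partner⇒isBlockTransposition (ab≡iq q<c c≤n c≢k) =
    C.glued-at-a⇒isBlockTransposition k≤n c≤n is-3rd
      (λ { (inj₁ k≡i) → <-irrefl (sym k≡i) W³.x<z ; (inj₂ (inj₁ k≡q)) → <-irrefl (sym k≡q) W.q<k
         ; (inj₂ (inj₂ k≡c)) → c≢k (sym k≡c) })
      (λ { is-1st _ → is-1st ; is-2nd _ → is-2nd ; is-3rd k≢k → ⊥-elim (k≢k refl) })
      (from C.continues-at-a⇔ (inj₁ (refl , refl)))
      ((λ (_ , c≡k) → c≢k c≡k) ∘ to C.continues-at-p⇔)
      ((λ { (inj₁ (q≡i , _)) → <-irrefl (sym q≡i) W.i<q ; (inj₂ (_ , c≡k)) → c≢k c≡k }) ∘ to C.continues-at-c⇔)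
    where module C = Composition i<j j<k W.i<q q<c
  partner⇒isBlockTransposition (ab≡qk k<c c≤n) =
    C.glued-at-a⇒isBlockTransposition k≤n c≤n is-1st
      (λ { (inj₁ i≡q) → <-irrefl i≡q W.i<q ; (inj₂ (inj₁ i≡k)) → <-irrefl i≡k W³.x<z
         ; (inj₂ (inj₂ i≡c)) → <-irrefl i≡c (<-trans W³.x<z k<c) })
      (λ { is-1st i≢i → ⊥-elim (i≢i refl) ; is-2nd _ → is-1st ; is-3rd _ → is-2nd })
      (from C.continues-at-a⇔ (inj₂ (refl , refl)))
      ((λ (q≡i , _) → <-irrefl (sym q≡i) W.i<q) ∘ to C.continues-at-p⇔)
      ((λ { (inj₁ (k≡i , _)) → <-irrefl (sym k≡i) W³.x<z ; (inj₂ (k≡q , _)) → <-irrefl (sym k≡q) W.q<k })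
        ∘ to C.continues-at-c⇔)
    where module C = Composition i<j j<k W.q<k k<c

  module _ {a b c : ℕ} (a<b : a < b) (b<c : b < c) (c≤n : c ≤ n)
    (isBT : IsBlockTransposition n (W ∘ btVal a b c)) where

    private
      module C = Composition i<j j<k a<b b<c

      not-inverse : ¬ (a ≡ i × b ≡ q × c ≡ k)
      not-inverse (a≡i , b≡q , c≡k) = isBlockTransposition⇒≉id isBT (C.inverse-composite a≡i b≡q c≡k)

    isBlockTransposition⇒partner : Partner (a , b , c)
    isBlockTransposition⇒partner with continues? (W ∘ btVal a b c) c
    ... | yes c-glued with to C.continues-at-c⇔ c-glued
    ...   | inj₁ (refl , refl) = bc≡iq a<b
    ...   | inj₂ (refl , refl) = bc≡qk a<b λ a≡i → not-inverse (a≡i , refl , refl)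
    isBlockTransposition⇒partner | no c-breaks with continues? (W ∘ btVal a b c) (pivot a b c)
    ... | yes p-glued with to C.continues-at-p⇔ p-glued
    ...   | refl , refl = ac≡ik a<b b<c λ b≡q → not-inverse (refl , b≡q , refl)
    isBlockTransposition⇒partner | no c-breaks | no p-breaks with continues? (W ∘ btVal a b c) a
    ... | yes a-glued with to C.continues-at-a⇔ a-glued
    ...   | inj₁ (refl , refl) = ab≡iq b<c c≤n λ c≡k → not-inverse (refl , refl , c≡k)
    ...   | inj₂ (refl , refl) = ab≡qk b<c c≤n
    isBlockTransposition⇒partner | no c-breaks | no p-breaks | no a-breaks =
      ⊥-elim (not-inverse (C.all-broken⇒inverse isBT a-breaks p-breaks c-breaks))

interval : ℕ → ℕ → List ℕ
interval s e = applyUpTo (s +_) (e ∸ s)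

∈-interval⁺ : ∀ {s e x} → s ≤ x → x < e → x ∈ interval s e
∈-interval⁺ {s} s≤x x<e = subst (_∈ _) (m+[n∸m]≡n s≤x) (∈-applyUpTo⁺ (s +_) (∸-monoˡ-< x<e s≤x))

∈-interval⁻ : ∀ {s e x} → x ∈ interval s e → s ≤ x × x < e
∈-interval⁻ {s} {e} x∈ with ∈-applyUpTo⁻ (s +_) x∈
... | r , r<e∸s , refl = m≤m+n s r , subst (s + r <_) (m+[n∸m]≡n s≤e) (+-monoʳ-< s r<e∸s)
  where
  s≤e : s ≤ e
  s≤e = <⇒≤ (m∸n≢0⇒n<m {e} {s} (m<n⇒n≢0 r<e∸s))

interval-unique : ∀ s e → Unique (interval s e)
interval-unique s e = applyUpTo⁺₁ (s +_) (e ∸ s) λ i<j _ → <⇒≢ (+-monoʳ-< s i<j)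

length-interval : ∀ s e → length (interval s e) ≡ e ∸ s
length-interval s e = length-applyUpTo (s +_) (e ∸ s)

punctured : ℕ → ℕ → ℕ → List ℕ
punctured s e h = interval s h ++ interval (suc h) e

∈-punctured⁺ : ∀ {s e h x} → s ≤ x → x < e → x ≢ h → x ∈ punctured s e h
∈-punctured⁺ {s} {e} {h} {x} s≤x x<e x≢h with x <? h
... | yes x<h = ∈-++⁺ˡ (∈-interval⁺ s≤x x<h)
... | no x≮h  = ∈-++⁺ʳ (interval s h) (∈-interval⁺ (≤∧≢⇒< (≮⇒≥ x≮h) (x≢h ∘ sym)) x<e)

∈-punctured⁻ : ∀ {s e h x} → s ≤ h → h < e → x ∈ punctured s e h → s ≤ x × x < e × x ≢ h
∈-punctured⁻ {s} {e} {h} s≤h h<e x∈ with ∈-++⁻ (interval s h) x∈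
... | inj₁ x∈l with ∈-interval⁻ x∈l
...   | s≤x , x<h = s≤x , <-trans x<h h<e , <⇒≢ x<h
∈-punctured⁻ {s} {e} {h} s≤h h<e x∈ | inj₂ x∈r with ∈-interval⁻ x∈r
...   | h<x , x<e = ≤-trans s≤h (<⇒≤ h<x) , x<e , (<⇒≢ h<x) ∘ sym

punctured-unique : ∀ s e h → Unique (punctured s e h)
punctured-unique s e h = ++⁺ (interval-unique s h) (interval-unique (suc h) e)
  λ (x∈l , x∈r) → <-asym (proj₂ (∈-interval⁻ x∈l)) (proj₁ (∈-interval⁻ {suc h} {e} x∈r))

length-punctured : ∀ s e h → length (punctured s e h) ≡ (h ∸ s) + (e ∸ suc h)
length-punctured s e h =
  trans (length-++ (interval s h) {interval (suc h) e}) (cong₂ _+_ (length-interval s h) (length-interval (suc h) e))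

length-concat : ∀ {A : Set} (xss : List (List A)) → length (concat xss) ≡ sum (map length xss)
length-concat []         = refl
length-concat (xs ∷ xss) = trans (length-++ xs) (cong (length xs +_) (length-concat xss))

map-disjoint : ∀ {A B : Set} {f g : A → B} {xs ys : List A} →
  (∀ {x y} → x ∈ xs → y ∈ ys → f x ≢ g y) → Disjoint (map f xs) (map g ys)
map-disjoint {f = f} {g} f≢g (v∈fxs , v∈gys) with ∈-map⁻ f v∈fxs | ∈-map⁻ g v∈gys
... | x , x∈ , refl | y , y∈ , fx≡gy = f≢g x∈ y∈ fx≡gy

map⁺-∈ : ∀ {A B : Set} {f : A → B} {xs : List A} →
  (∀ {x y} → x ∈ xs → y ∈ xs → f x ≡ f y → x ≡ y) → Unique xs → Unique (map f xs)
map⁺-∈ {xs = []}     _   []          = []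
map⁺-∈ {xs = x ∷ xs} inj (x∉ ∷ uniq) =
  All.map⁺ (All.tabulate λ y∈ fx≡fy → All.lookup x∉ y∈ (inj (here refl) (there y∈) fx≡fy))
  ∷ map⁺-∈ (λ x∈ y∈ → inj (there x∈) (there y∈)) uniq

module PartnerList {n i j k : ℕ} (i<j : i < j) (j<k : j < k) (k≤n : k ≤ n) where

  open Neighbours i<j j<k k≤n using (q; Partner; bc≡iq; bc≡qk; ac≡ik; ab≡iq; ab≡qk)

  private
    module W = BlockTransposition i<j j<k
    module W³ = ThreeBlocks W.threeBlocks

  families : List (List (ℕ × ℕ × ℕ))
  families =
    map (λ a → a , i , q) (interval 0 i) ∷
    map (λ a → a , q , k) (punctured 0 q i) ∷
    map (λ b → i , b , k) (punctured (suc i) k q) ∷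
    map (λ c → i , q , c) (punctured (suc q) (suc n) k) ∷
    map (λ c → q , k , c) (interval (suc k) (suc n)) ∷ []

  partners : List (ℕ × ℕ × ℕ)
  partners = concat families

  ∈-partners⁺ : ∀ {t} → Partner t → t ∈ partners
  ∈-partners⁺ = ∈-concat⁺ ∘ in-family
    where
    in-family : ∀ {t} → Partner t → Any (t ∈_) families
    in-family (bc≡iq a<i)         = here (∈-map⁺ _ (∈-interval⁺ z≤n a<i))
    in-family (bc≡qk a<q a≢i)     = there (here (∈-map⁺ _ (∈-punctured⁺ z≤n a<q a≢i)))
    in-family (ac≡ik i<b b<k b≢q) = there (there (here (∈-map⁺ _ (∈-punctured⁺ i<b b<k b≢q))))
    in-family (ab≡iq q<c c≤n c≢k) = there (there (there (here (∈-map⁺ _ (∈-punctured⁺ q<c (s≤s c≤n) c≢k)))))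
    in-family (ab≡qk k<c c≤n)     = there (there (there (there (here (∈-map⁺ _ (∈-interval⁺ k<c (s≤s c≤n)))))))

  ∈-partners⁻ : ∀ {t} → t ∈ partners → Partner t
  ∈-partners⁻ t∈ with ∈-concat⁻ families t∈
  ... | here t∈F with ∈-map⁻ _ t∈F
  ...   | a , a∈ , refl = bc≡iq (proj₂ (∈-interval⁻ a∈))
  ∈-partners⁻ t∈ | there (here t∈F) with ∈-map⁻ _ t∈F
  ...   | a , a∈ , refl with ∈-punctured⁻ z≤n W.i<q a∈
  ...     | _ , a<q , a≢i = bc≡qk a<q a≢i
  ∈-partners⁻ t∈ | there (there (here t∈F)) with ∈-map⁻ _ t∈F
  ...   | b , b∈ , refl with ∈-punctured⁻ W.i<q W.q<k b∈
  ...     | i<b , b<k , b≢q = ac≡ik i<b b<k b≢q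
  ∈-partners⁻ t∈ | there (there (there (here t∈F))) with ∈-map⁻ _ t∈F
  ...   | c , c∈ , refl with ∈-punctured⁻ W.q<k (s≤s k≤n) c∈
  ...     | q<c , c<1+n , c≢k = ab≡iq q<c (≤-pred c<1+n) c≢k
  ∈-partners⁻ t∈ | there (there (there (there (here t∈F)))) with ∈-map⁻ _ t∈F
  ...   | c , c∈ , refl with ∈-interval⁻ c∈
  ...     | k<c , c<1+n = ab≡qk k<c (≤-pred c<1+n)

  partners-unique : Unique partners
  partners-unique = concat⁺ families-unique families-disjoint
    where
    i≢q : i ≢ q
    i≢q = <⇒≢ W.i<q
    q≢k : q ≢ k
    q≢k = <⇒≢ W.q<k
    i≢k : i ≢ k
    i≢k = <⇒≢ W³.x<z
    a≢i : ∀ {a} → a ∈ punctured 0 q i → a ≢ i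
    a≢i a∈ = proj₂ (proj₂ (∈-punctured⁻ z≤n W.i<q a∈))
    b≢q : ∀ {b} → b ∈ punctured (suc i) k q → b ≢ q
    b≢q b∈ = proj₂ (proj₂ (∈-punctured⁻ W.i<q W.q<k b∈))

    families-unique : All.All Unique families
    families-unique =
      map⁺-∈ (λ _ _ → cong proj₁) (interval-unique 0 i) All.∷
      map⁺-∈ (λ _ _ → cong proj₁) (punctured-unique 0 q i) All.∷
      map⁺-∈ (λ _ _ → cong (proj₁ ∘ proj₂)) (punctured-unique (suc i) k q) All.∷
      map⁺-∈ (λ _ _ → cong (proj₂ ∘ proj₂)) (punctured-unique (suc q) (suc n) k) All.∷
      map⁺-∈ (λ _ _ → cong (proj₂ ∘ proj₂)) (interval-unique (suc k) (suc n)) All.∷ All.[]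

    families-disjoint : AllPairs Disjoint families
    families-disjoint =
      (map-disjoint (λ _ _ → i≢q ∘ cong (proj₁ ∘ proj₂)) All.∷
       map-disjoint (λ _ _ → q≢k ∘ cong (proj₂ ∘ proj₂)) All.∷
       map-disjoint (λ _ _ → i≢q ∘ cong (proj₁ ∘ proj₂)) All.∷
       map-disjoint (λ _ _ → i≢k ∘ cong (proj₁ ∘ proj₂)) All.∷ All.[]) ∷
      (map-disjoint (λ a∈ _ → a≢i a∈ ∘ cong proj₁) All.∷
       map-disjoint (λ a∈ _ → a≢i a∈ ∘ cong proj₁) All.∷
       map-disjoint (λ _ _ → q≢k ∘ cong (proj₁ ∘ proj₂)) All.∷ All.[]) ∷
      (map-disjoint (λ b∈ _ → b≢q b∈ ∘ cong (proj₁ ∘ proj₂)) All.∷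
       map-disjoint (λ _ _ → i≢q ∘ cong proj₁) All.∷ All.[]) ∷
      (map-disjoint (λ _ _ → i≢q ∘ cong proj₁) All.∷ All.[]) ∷
      All.[] ∷ []

  length-partners : length partners ≡ 2 * (n ∸ 2)
  length-partners = begin
    length (concat families)     ≡⟨ length-concat families ⟩
    sum (map length families)    ≡⟨ cong sum lengths ⟩
    i + (i + u + (u + v + (v + w + (w + 0)))) ≡⟨ solve-∀' i u v w ⟩
    2 * (i + u + v + w)          ≡⟨ cong (2 *_) (sym n∸2) ⟩
    2 * (n ∸ 2)                  ∎
    where
    open ≡-Reasoning
    u v w : ℕ
    u = q ∸ suc i
    v = k ∸ suc q
    w = n ∸ k
    lengths : map length families ≡ i ∷ i + u ∷ u + v ∷ v + w ∷ w ∷ []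
    lengths =
      cong₂ _∷_ (trans (length-map _ (interval 0 i)) (length-interval 0 i)) (
      cong₂ _∷_ (trans (length-map _ (punctured 0 q i)) (length-punctured 0 q i)) (
      cong₂ _∷_ (trans (length-map _ (punctured (suc i) k q)) (length-punctured (suc i) k q)) (
      cong₂ _∷_ (trans (length-map _ (punctured (suc q) (suc n) k)) (length-punctured (suc q) (suc n) k)) (
      cong₂ _∷_ (trans (length-map _ (interval (suc k) (suc n))) (length-interval (suc k) (suc n))) refl))))
    n≡2+ : 2 + (i + u + v + w) ≡ n
    n≡2+ = begin
      suc (suc i + u) + v + w  ≡⟨ cong (λ m → suc m + v + w) (m+[n∸m]≡n W.i<q) ⟩
      suc q + v + w            ≡⟨ cong (_+ w) (m+[n∸m]≡n W.q<k) ⟩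
      k + w                    ≡⟨ m+[n∸m]≡n k≤n ⟩
      n                        ∎
    n∸2 : n ∸ 2 ≡ i + u + v + w
    n∸2 = trans (cong (_∸ 2) (sym n≡2+)) (m+n∸m≡n 2 (i + u + v + w))
    solve-∀' : ∀ i u v w → i + (i + u + (u + v + (v + w + (w + 0)))) ≡ 2 * (i + u + v + w)
    solve-∀' = solve-∀

-- From functions on ℕ to permutations of [n]

record Represents {n} (ρ : Perm n) (g : ℕ → ℕ) : Set where
  constructor represents
  field toℕ-lookup : ∀ t → toℕ (lookup ρ t) ≡ g (toℕ t)

open Represents

represents-σ : ∀ {n i j k} → i < j → j < k → k ≤ n → Represents (σ n i j k) (btVal i j k)
represents-σ {n} {i} {j} {k} i<j j<k k≤n =
  represents λ t → trans (cong toℕ (lookup∘tabulate (btFin i j k) t)) (toℕ-btFin t)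
  where
  toℕ-btFin : ∀ t → toℕ (btFin {n} i j k t) ≡ btVal i j k (toℕ t)
  toℕ-btFin t with btVal i j k (toℕ t) <? n
  ... | yes v<n = toℕ-fromℕ< v<n
  ... | no v≮n  = ⊥-elim (v≮n (BlockTransposition.bounded i<j j<k (toℕ t) k≤n (toℕ<n t)))

represents-∘ₚ : ∀ {n} {π ρ : Perm n} {f g : ℕ → ℕ} → Represents π f → Represents ρ g → Represents (π ∘ₚ ρ) (f ∘ g)
represents-∘ₚ {π = π} {ρ} {f} π~f ρ~g = represents λ t →
  trans (cong toℕ (lookup∘tabulate (λ s → lookup π (lookup ρ s)) t))
        (trans (toℕ-lookup π~f (lookup ρ t)) (cong f (toℕ-lookup ρ~g t)))

represents-resp-≗ : ∀ {n} {ρ : Perm n} {f g : ℕ → ℕ} → f ≗ g → Represents ρ f → Represents ρ g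
represents-resp-≗ f≗g ρ~f = represents λ t → trans (toℕ-lookup ρ~f t) (f≗g _)

represents-injective : ∀ {n} {ρ ρ′ : Perm n} {g : ℕ → ℕ} → Represents ρ g → Represents ρ′ g → ρ ≡ ρ′
represents-injective {ρ = ρ} {ρ′} ρ~g ρ′~g = begin
  ρ                    ≡⟨ sym (tabulate∘lookup ρ) ⟩
  tabulate (lookup ρ)  ≡⟨ tabulate-cong (λ t → toℕ-injective (trans (toℕ-lookup ρ~g t) (sym (toℕ-lookup ρ′~g t)))) ⟩
  tabulate (lookup ρ′) ≡⟨ tabulate∘lookup ρ′ ⟩
  ρ′                   ∎
  where open ≡-Reasoning

represents-≗ : ∀ {n} {ρ : Perm n} {f g : ℕ → ℕ} → Represents ρ f → Represents ρ g →
  (∀ t → n ≤ t → f t ≡ t) → (∀ t → n ≤ t → g t ≡ t) → f ≗ g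
represents-≗ {n} {f = f} {g} ρ~f ρ~g f-fixes g-fixes t with t <? n
... | yes t<n = subst (λ m → f m ≡ g m) (toℕ-fromℕ< t<n)
                  (trans (sym (toℕ-lookup ρ~f (fromℕ< t<n))) (toℕ-lookup ρ~g (fromℕ< t<n)))
... | no t≮n  = trans (f-fixes t (≮⇒≥ t≮n)) (sym (g-fixes t (≮⇒≥ t≮n)))

module Neighbourhood {n i j k : ℕ} (i<j : i < j) (j<k : j < k) (k≤n : k ≤ n) where

  open Neighbours i<j j<k k≤n using (partner-valid; partner⇒isBlockTransposition; isBlockTransposition⇒partner)
  open PartnerList i<j j<k k≤n using (partners; ∈-partners⁺; ∈-partners⁻; partners-unique; length-partners)

  private
    W : ℕ → ℕ
    W = btVal i j k

  π : Perm n
  π = σ n i j k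

  compose : ℕ × ℕ × ℕ → Perm n
  compose (a , b , c) = π ∘ₚ σ n a b c

  neighbours : List (Perm n)
  neighbours = map compose partners

  module _ {a b c : ℕ} (a<b : a < b) (b<c : b < c) (c≤n : c ≤ n) where

    represents-compose : Represents (compose (a , b , c)) (W ∘ btVal a b c)
    represents-compose = represents-∘ₚ (represents-σ i<j j<k k≤n) (represents-σ a<b b<c c≤n)

    composite-fixes : ∀ t → n ≤ t → (W ∘ btVal a b c) t ≡ t
    composite-fixes = IsPermutationBelow.fixes (Composition.isPermutationBelow i<j j<k a<b b<c k≤n c≤n)

  ∈-neighbours⁺ : ∀ {ρ} → ρ ∈ neighbours → IsBT n ρ × Adj n π ρ
  ∈-neighbours⁺ ρ∈ with ∈-map⁻ compose ρ∈
  ... | (a , b , c) , t∈ , refl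
    with partner-valid (∈-partners⁻ t∈) | partner⇒isBlockTransposition (∈-partners⁻ t∈)
  ...   | a<b , b<c , c≤n | d , e , f , d<e , e<f , f≤n , W∘τ≗σ =
    (d , e , f , d<e , e<f , f≤n ,
      represents-injective (represents-resp-≗ W∘τ≗σ (represents-compose a<b b<c c≤n)) (represents-σ d<e e<f f≤n)) ,
    σ n a b c , (a , b , c , a<b , b<c , c≤n , refl) , refl

  ∈-neighbours⁻ : ∀ {ρ} → IsBT n ρ → Adj n π ρ → ρ ∈ neighbours
  ∈-neighbours⁻ (d , e , f , d<e , e<f , f≤n , refl) (_ , (a , b , c , a<b , b<c , c≤n , refl) , σ≡) =
    subst (_∈ neighbours) (sym σ≡)
      (∈-map⁺ compose (∈-partners⁺ (isBlockTransposition⇒partner a<b b<c c≤n (d , e , f , d<e , e<f , f≤n , W∘τ≗σ))))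
    where
    W∘τ≗σ : W ∘ btVal a b c ≗ btVal d e f
    W∘τ≗σ = represents-≗ (represents-compose a<b b<c c≤n)
      (subst (λ ρ → Represents ρ (btVal d e f)) σ≡ (represents-σ d<e e<f f≤n))
      (composite-fixes a<b b<c c≤n) (λ t n≤t → BlockTransposition.fixes d<e e<f t (≤-trans f≤n n≤t))

  compose-injective : ∀ {t u} → t ∈ partners → u ∈ partners → compose t ≡ compose u → t ≡ u
  compose-injective {a , b , c} {a′ , b′ , c′} t∈ u∈ compose≡
    with partner-valid (∈-partners⁻ t∈) | partner-valid (∈-partners⁻ u∈)
  ... | a<b , b<c , c≤n | a′<b′ , b′<c′ , c′≤n = btVal-≗⇒≡ a<b b<c a′<b′ b′<c′ λ t → W.injective (W∘τ≗W∘τ′ t)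
    where
    module W = BlockTransposition i<j j<k
    W∘τ≗W∘τ′ : W ∘ btVal a b c ≗ W ∘ btVal a′ b′ c′
    W∘τ≗W∘τ′ = represents-≗ (represents-compose a<b b<c c≤n)
      (subst (λ ρ → Represents ρ (W ∘ btVal a′ b′ c′)) (sym compose≡) (represents-compose a′<b′ b′<c′ c′≤n))
      (composite-fixes a<b b<c c≤n) (composite-fixes a′<b′ b′<c′ c′≤n)

  hasDegree : HasDegreeInT n π (2 * (n ∸ 2))
  hasDegree =
    neighbours ,
    map⁺-∈ compose-injective partners-unique ,
    (λ ρ → mk⇔ ∈-neighbours⁺ λ (isBT , adj) → ∈-neighbours⁻ isBT adj) ,
    trans (length-map compose partners) length-partners

proposition4 : ∀ n → 5 ≤ n → InducedRegular n (2 * (n ∸ 2))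
proposition4 n _ π (i , j , k , i<j , j<k , k≤n , refl) = Neighbourhood.hasDegree i<j j<k k≤n
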